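{- For every integer $r\geq 1$, if $G$ is a connected $(P_4\cup rK_1)$-free graph, then $\gamma_t(G)\leq 2r+2$.
   Context: All graphs are finite, simple and undirected. A vertex subset $D$ of $G$ is a total dominating set if every vertex of $G$ is adjacent to some vertex of $D$; $\gamma_t(G)$ is the minimum size of a total dominating set. A graph is $H$-free if it has no induced subgraph isomorphic to $H$. $P_4$ is the path on four vertices, $rK_1$ the edgeless graph on $r$ vertices, and $\cup$ denotes disjoint union. -}

module Defs where

open import Data.Nat using (ℕ; zero; suc; _+_; _<_; _≤_)
open import Data.Fin using (Fin; toℕ)
open import Data.Fin.Subset using (Subset; _∈_; ∣_∣)
open import Data.Product using (Σ; ∃; _×_; _,_)
open import Data.Empty using (⊥)
open import Function.Bundles using (_⇔_)
open import Function.Definitions using (Injective)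
open import Relation.Binary.PropositionalEquality using (_≡_)
open import Relation.Nullary using (¬_; Dec)
open import Level using (0ℓ)

record Graph (n : ℕ) : Set₁ where
  field
    Adj     : Fin n → Fin n → Set
    sym     : ∀ {u v} → Adj u v → Adj v u
    irrefl  : ∀ {u} → ¬ Adj u u
    adj?    : ∀ u v → Dec (Adj u v)
open Graph public

data Reach {n : ℕ} (G : Graph n) : Fin n → Fin n → Set where
  here : ∀ {u} → Reach G u u
  step : ∀ {u v w} → Adj G u v → Reach G v w → Reach G u w

Connected : ∀ {n} → Graph n → Set
Connected G = ∀ u v → Reach G u v

InducedSub : ∀ {k n} → Graph k → Graph n → Set
InducedSub {k} {n} H G =
  Σ (Fin k → Fin n) λ f →
    Injective _≡_ _≡_ f × (∀ i j → Adj H i j ⇔ Adj G (f i) (f j))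

Free : ∀ {k n} → Graph k → Graph n → Set
Free H G = ¬ InducedSub H G

-- P₄ ∪ rK₁ on vertex set Fin (4 + r): vertices 0,1,2,3 form the path
-- 0-1-2-3; the remaining r vertices are isolated.
data P4rAdj {m : ℕ} : Fin m → Fin m → Set where
  fwd : ∀ {i j} → toℕ j < 4 → suc (toℕ i) ≡ toℕ j → P4rAdj i j
  bwd : ∀ {i j} → toℕ i < 4 → suc (toℕ j) ≡ toℕ i → P4rAdj i j

private
  open import Data.Nat.Properties as ℕP using ()
  open import Data.Sum using (inj₁; inj₂)
  open import Relation.Nullary using (yes; no)
  open import Relation.Binary.PropositionalEquality using (refl; trans; sym)
  import Data.Nat as N
  import Data.Nat.Properties as NP

  p-sym : ∀ {m} {i j : Fin m} → P4rAdj i j → P4rAdj j i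
  p-sym (fwd a b) = bwd a b
  p-sym (bwd a b) = fwd a b

  p-irr : ∀ {m} {i : Fin m} → ¬ P4rAdj i i
  p-irr (fwd _ e) = NP.1+n≢n e
  p-irr (bwd _ e) = NP.1+n≢n e

  p-dec : ∀ {m} (i j : Fin m) → Dec (P4rAdj i j)
  p-dec i j with toℕ j N.<? 4 | suc (toℕ i) NP.≟ toℕ j | toℕ i N.<? 4 | suc (toℕ j) NP.≟ toℕ i
  ... | yes a | yes b | _ | _ = yes (fwd a b)
  ... | _ | _ | yes c | yes d = yes (bwd c d)
  ... | no a | _ | no c | _ = no λ { (fwd x _) → a x ; (bwd x _) → c x }
  ... | no a | _ | yes c | no d = no λ { (fwd x _) → a x ; (bwd _ y) → d y }
  ... | yes a | no b | no c | _ = no λ { (fwd _ y) → b y ; (bwd x _) → c x }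
  ... | yes a | no b | yes c | no d = no λ { (fwd _ y) → b y ; (bwd _ y) → d y }

P4∪rK1 : (r : ℕ) → Graph (4 + r)
P4∪rK1 r = record { Adj = P4rAdj ; sym = p-sym ; irrefl = p-irr ; adj? = p-dec }

TotalDominating : ∀ {n} → Graph n → Subset n → Set
TotalDominating {n} G D = ∀ (v : Fin n) → ∃ λ u → u ∈ D × Adj G v u

γt≤ : ∀ {n} → Graph n → ℕ → Set
γt≤ G k = ∃ λ D → TotalDominating G D × ∣ D ∣ ≤ k

-- A connected graph with an edge either has a dominating edge (so γt ≤ 2) or
-- an induced P₄. Start from an edge uv; if a vertex x misses N(u) ∪ N(v), a
-- path from u to x leaves N(u) ∪ N(v) along an edge yz with y a neighbour of
-- u, say. Then u, v, y, z and a neighbour of v contain an induced P₄, or uy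
-- is an edge with strictly larger N(u) ∪ N(y); the latter can happen at most
-- n times.
-- Given an induced P₄, take a maximal independent set S among the vertices
-- with no neighbour on it. If |S| ≥ r, the P₄ and r vertices of S induce
-- P₄ ∪ rK₁. Otherwise the P₄, S and one neighbour of each vertex of S form a
-- total dominating set of size at most 4 + 2(r - 1) = 2r + 2.
module Submission where

open import Defs
open import Data.Nat using (ℕ; zero; suc; _+_; _*_; _≤_; _<_; z≤n; s≤s)
import Data.Nat.Properties as ℕ
open import Data.Nat.Tactic.RingSolver using (solve-∀)
open import Data.Fin as Fin using (Fin; toℕ)
import Data.Fin.Properties as Fin
open import Data.Fin.Subset as Sub using (Subset; _∈_; _∪_; _⊆_; _⊂_; ∣_∣)
import Data.Fin.Subset.Properties as Sub
open import Data.Vec using (tabulate; _[_]≔_; _∷_)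
import Data.Vec.Properties as Vec
open import Data.Bool using (true)
open import Data.List as List using (List; []; _∷_; _++_; length)
import Data.List.Properties as List
open import Data.List.Relation.Unary.All as All using (All; []; _∷_)
import Data.List.Relation.Unary.All.Properties as All
open import Data.List.Relation.Unary.Any as Any using (Any; here; there)
open import Data.List.Relation.Unary.AllPairs using (AllPairs; []; _∷_)
open import Data.List.Membership.Propositional using (find) renaming (_∈_ to _∈ₗ_)
import Data.List.Membership.Propositional.Properties as Membership
open import Data.Product using (∃; ∃₂; _×_; _,_; proj₁; proj₂)
open import Data.Sum using (_⊎_; inj₁; inj₂; [_,_]′; swap)
open import Data.Empty using (⊥-elim)
open import Function using (_∘_)
open import Function.Bundles using (_⇔_; mk⇔)
open import Relation.Nullary using (¬_; Dec; yes; no; does)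
open import Relation.Nullary.Decidable using (dec-true; decidable-stable; ¬?; _×-dec_; _⊎-dec_)
open import Relation.Unary using (Decidable)
open import Relation.Binary.PropositionalEquality using (_≡_; _≢_; refl; cong; subst)
  renaming (sym to ≡-sym; trans to ≡-trans)

fromList : ∀ {m} → List (Fin m) → Subset m
fromList []       = Sub.⊥
fromList (x ∷ xs) = fromList xs [ x ]≔ true

∣p[x]≔true∣≤1+∣p∣ : ∀ {m} (x : Fin m) (p : Subset m) → ∣ p [ x ]≔ true ∣ ≤ suc ∣ p ∣
∣p[x]≔true∣≤1+∣p∣ Fin.zero    (s ∷ p)        = s≤s (Sub.∣p∣≤∣x∷p∣ s p)
∣p[x]≔true∣≤1+∣p∣ (Fin.suc x) (Sub.inside ∷ p)  = s≤s (∣p[x]≔true∣≤1+∣p∣ x p)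
∣p[x]≔true∣≤1+∣p∣ (Fin.suc x) (Sub.outside ∷ p) = ∣p[x]≔true∣≤1+∣p∣ x p

∣fromList∣≤length : ∀ {m} (xs : List (Fin m)) → ∣ fromList xs ∣ ≤ length xs
∣fromList∣≤length {m} []   = ℕ.≤-reflexive (Sub.∣⊥∣≡0 m)
∣fromList∣≤length (x ∷ xs) =
  ℕ.≤-trans (∣p[x]≔true∣≤1+∣p∣ x (fromList xs)) (s≤s (∣fromList∣≤length xs))

∈fromList⁺ : ∀ {m} {y : Fin m} (xs : List (Fin m)) → y ∈ₗ xs → y ∈ fromList xs
∈fromList⁺ (x ∷ xs) (here refl) = Vec.[]≔-updates (fromList xs) x
∈fromList⁺ {y = y} (x ∷ xs) (there y∈xs) with y Fin.≟ x
... | yes refl = Vec.[]≔-updates (fromList xs) x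
... | no y≢x   = Vec.[]≔-minimal (fromList xs) y x y≢x (∈fromList⁺ xs y∈xs)

AllPairs-lookup : ∀ {A : Set} {R : A → A → Set} → (∀ {x y} → R x y → R y x) →
                  ∀ {xs} → AllPairs R xs → ∀ {i j} → i ≢ j →
                  R (List.lookup xs i) (List.lookup xs j)
AllPairs-lookup R-sym (_ ∷ _)   {Fin.zero}  {Fin.zero}  i≢j = ⊥-elim (i≢j refl)
AllPairs-lookup R-sym (Rx ∷ _)  {Fin.zero}  {Fin.suc j} _   = All.lookup Rx (Membership.∈-lookup j)
AllPairs-lookup R-sym (Rx ∷ _)  {Fin.suc i} {Fin.zero}  _   = R-sym (All.lookup Rx (Membership.∈-lookup i))
AllPairs-lookup R-sym (_ ∷ Rxs) {Fin.suc i} {Fin.suc j} i≢j = AllPairs-lookup R-sym Rxs (i≢j ∘ cong Fin.suc)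

4+2l≤2r+2 : ∀ {l r} → l < r → 4 + (l + l) ≤ 2 * r + 2
4+2l≤2r+2 {l} {r} l<r =
  subst (_≤ 2 * r + 2) (≡-sym (shape l)) (ℕ.+-monoˡ-≤ 2 (ℕ.*-monoʳ-≤ 2 l<r))
  where
  shape : ∀ l → 4 + (l + l) ≡ 2 * suc l + 2
  shape = solve-∀

pattern 0F    = Fin.zero
pattern 1F    = Fin.suc 0F
pattern 2F    = Fin.suc 1F
pattern 3F    = Fin.suc 2F
pattern iso j = Fin.suc (Fin.suc (Fin.suc (Fin.suc j)))

¬P4rAdj : ∀ {m} {i j : Fin m} → suc (toℕ i) ≢ toℕ j → suc (toℕ j) ≢ toℕ i → ¬ P4rAdj i j
¬P4rAdj i+1≢j _ (fwd _ e) = i+1≢j e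
¬P4rAdj _ j+1≢i (bwd _ e) = j+1≢i e

isolatedˡ : ∀ {r i} {j : Fin (4 + r)} → ¬ P4rAdj (iso i) j
isolatedˡ (bwd i<4 _) = ℕ.m+n≮m 4 _ i<4
isolatedˡ (fwd j<4 e) = ℕ.m+n≮m 4 _ (subst (_< 4) (≡-sym e) j<4)

isolatedʳ : ∀ {r} {i : Fin (4 + r)} {j} → ¬ P4rAdj i (iso j)
isolatedʳ (fwd j<4 _) = ℕ.m+n≮m 4 _ j<4
isolatedʳ (bwd i<4 e) = ℕ.m+n≮m 4 _ (subst (_< 4) (≡-sym e) i<4)

both⇔ : ∀ {P Q : Set} → P → Q → P ⇔ Q
both⇔ p q = mk⇔ (λ _ → q) (λ _ → p)

neither⇔ : ∀ {P Q : Set} → ¬ P → ¬ Q → P ⇔ Q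
neither⇔ ¬p ¬q = mk⇔ (⊥-elim ∘ ¬p) (⊥-elim ∘ ¬q)

module _ {n : ℕ} (G : Graph n) where

  open Graph G using () renaming (Adj to _~_; sym to ~-sym; irrefl to ~-irrefl; adj? to _~?_)

  ≁-sym : ∀ {x y} → ¬ x ~ y → ¬ y ~ x
  ≁-sym x≁y = x≁y ∘ ~-sym

  ~⇒≢ : ∀ {x y} → x ~ y → x ≢ y
  ~⇒≢ x~x refl = ~-irrefl x~x

  separated : ∀ {x y z} → x ~ z → ¬ y ~ z → x ≢ y
  separated x~z y≁z refl = y≁z x~z

  Reach⇒neighbour : ∀ {u w} → Reach G u w → u ≢ w → ∃ (u ~_)
  Reach⇒neighbour here         u≢u = ⊥-elim (u≢u refl)
  Reach⇒neighbour (step u~v _) _   = _ , u~v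

  has-neighbour : Connected G → ∀ {x y : Fin n} → x ≢ y → ∀ v → ∃ (v ~_)
  has-neighbour con {x} {y} x≢y v with v Fin.≟ x
  ... | yes refl = Reach⇒neighbour (con v y) x≢y
  ... | no v≢x   = Reach⇒neighbour (con v x) v≢x

  exit-edge : (T : Fin n → Set) → Decidable T → ∀ {u x} → T u → ¬ T x → Reach G u x →
              ∃₂ λ y z → T y × ¬ T z × y ~ z
  exit-edge T T? Tu ¬Tx here = ⊥-elim (¬Tx Tu)
  exit-edge T T? {u} Tu ¬Tx (step {v = v} u~v v⇝x) with T? v
  ... | yes Tv = exit-edge T T? Tv ¬Tx v⇝x
  ... | no ¬Tv = u , v , Tu , ¬Tv , u~v

  γt≤length : (xs : List (Fin n)) → (∀ v → ∃ λ u → u ∈ₗ xs × v ~ u) → γt≤ G (length xs)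
  γt≤length xs dom = fromList xs , dominating , ∣fromList∣≤length xs
    where
    dominating : TotalDominating G (fromList xs)
    dominating v with dom v
    ... | u , u∈xs , v~u = u , ∈fromList⁺ xs u∈xs , v~u

  γt≤-mono : ∀ {k m} → k ≤ m → γt≤ G k → γt≤ G m
  γt≤-mono k≤m (D , dom , ∣D∣≤k) = D , dom , ℕ.≤-trans ∣D∣≤k k≤m

  Covers : Fin n → Fin n → Fin n → Set
  Covers u v w = w ~ u ⊎ w ~ v

  Covers? : ∀ u v → Decidable (Covers u v)
  Covers? u v w = (w ~? u) ⊎-dec (w ~? v)

  DominatingEdge : Set
  DominatingEdge = ∃₂ λ u v → u ~ v × ∀ w → Covers u v w

  DominatingEdge⇒γt≤2 : DominatingEdge → γt≤ G 2
  DominatingEdge⇒γt≤2 (u , v , _ , covers) = γt≤length (u ∷ v ∷ []) dom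
    where
    dom : ∀ w → ∃ λ x → x ∈ₗ u ∷ v ∷ [] × w ~ x
    dom w with covers w
    ... | inj₁ w~u = u , here refl , w~u
    ... | inj₂ w~v = v , there (here refl) , w~v

  record InducedP4 : Set where
    constructor inducedP4
    field
      a b c d : Fin n
      a~b : a ~ b
      b~c : b ~ c
      c~d : c ~ d
      a≁c : ¬ a ~ c
      a≁d : ¬ a ~ d
      b≁d : ¬ b ~ d

  N : Fin n → Subset n
  N u = tabulate (λ w → does (w ~? u))

  ∈N⁺ : ∀ {w u} → w ~ u → w ∈ N u
  ∈N⁺ {w} {u} w~u =
    Vec.lookup⇒[]= w (N u) (≡-trans (Vec.lookup∘tabulate _ w) (dec-true (w ~? u) w~u))

  ∈N⁻ : ∀ {w u} → w ∈ N u → w ~ u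
  ∈N⁻ {w} {u} w∈Nu = from (w ~? u) (≡-trans (≡-sym (Vec.lookup∘tabulate _ w)) (Vec.[]=⇒lookup w∈Nu))
    where
    from : (w~?u : Dec (w ~ u)) → does w~?u ≡ true → w ~ u
    from (yes w~u) _ = w~u

  N₂ : Fin n → Fin n → Subset n
  N₂ u v = N u ∪ N v

  ∈N₂⁺ : ∀ {u v w} → Covers u v w → w ∈ N₂ u v
  ∈N₂⁺ (inj₁ w~u) = Sub.x∈p∪q⁺ (inj₁ (∈N⁺ w~u))
  ∈N₂⁺ (inj₂ w~v) = Sub.x∈p∪q⁺ (inj₂ (∈N⁺ w~v))

  ∈N₂⁻ : ∀ {u v w} → w ∈ N₂ u v → Covers u v w
  ∈N₂⁻ {u} {v} w∈N₂ with Sub.x∈p∪q⁻ (N u) (N v) w∈N₂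
  ... | inj₁ w∈Nu = inj₁ (∈N⁻ w∈Nu)
  ... | inj₂ w∈Nv = inj₂ (∈N⁻ w∈Nv)

  N₂-⊂ : ∀ {u v y x} → (∀ {w} → w ~ v → Covers u y w) → x ~ y → ¬ Covers u v x →
         N₂ u v ⊂ N₂ u y
  N₂-⊂ {u} N[v]⊆ x~y ¬cx = ⊆ , _ , ∈N₂⁺ (inj₂ x~y) , ¬cx ∘ ∈N₂⁻
    where
    ⊆ : N₂ u _ ⊆ N₂ u _
    ⊆ w∈N₂ with ∈N₂⁻ w∈N₂
    ... | inj₁ w~u = ∈N₂⁺ (inj₁ w~u)
    ... | inj₂ w~v = ∈N₂⁺ (N[v]⊆ w~v)

  -- If y ≁ v, v-u-y-x is an induced P₄; otherwise a neighbour z of v missing u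
  -- and y yields z-v-y-x or u-y-x-z, and without such z, N(v) ⊆ N(u) ∪ N(y).
  inducedP4-or-wider : ∀ {u v y x} → u ~ v → y ~ u → y ~ x → ¬ Covers u v x →
                       InducedP4 ⊎ ∣ N₂ u v ∣ < ∣ N₂ u y ∣
  inducedP4-or-wider {u} {v} {y} {x} u~v y~u y~x ¬cx with y ~? v
  ... | no y≁v = inj₁ (inducedP4 v u y x (~-sym u~v) (~-sym y~u) y~x
                         (≁-sym y≁v) (≁-sym (¬cx ∘ inj₂)) (≁-sym (¬cx ∘ inj₁)))
  ... | yes y~v with Fin.any? (λ z → (z ~? v) ×-dec ¬? (Covers? u y z))
  ...   | no ∄z = inj₂ (Sub.p⊂q⇒∣p∣<∣q∣ (N₂-⊂ N[v]⊆ (~-sym y~x) ¬cx))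
    where
    N[v]⊆ : ∀ {w} → w ~ v → Covers u y w
    N[v]⊆ {w} w~v = decidable-stable (Covers? u y w) (λ ¬cw → ∄z (w , w~v , ¬cw))
  ...   | yes (z , z~v , ¬cz) with z ~? x
  ...     | yes z~x = inj₁ (inducedP4 u y x z (~-sym y~u) y~x (~-sym z~x)
                              (≁-sym (¬cx ∘ inj₁)) (≁-sym (¬cz ∘ inj₁)) (≁-sym (¬cz ∘ inj₂)))
  ...     | no z≁x  = inj₁ (inducedP4 z v y x z~v (~-sym y~v) y~x
                              (¬cz ∘ inj₂) z≁x (≁-sym (¬cx ∘ inj₂)))

  dominatingEdge-or-inducedP4 : Connected G → ∀ {u v} → u ~ v → DominatingEdge ⊎ InducedP4
  dominatingEdge-or-inducedP4 con u~v = search (suc n) u~v (ℕ.m≤m+n (suc n) _)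
    where
    spend : ∀ {fuel k l} → n < suc fuel + k → k < l → n < fuel + l
    spend {fuel} {k} {l} n< k<l =
      ℕ.<-≤-trans n< (subst (_≤ fuel + l) (ℕ.+-suc fuel k) (ℕ.+-monoʳ-≤ fuel k<l))

    search : (fuel : ℕ) → ∀ {u v} → u ~ v → n < fuel + ∣ N₂ u v ∣ → DominatingEdge ⊎ InducedP4
    search zero {u} {v} _ n< = ⊥-elim (ℕ.<⇒≱ n< (Sub.∣p∣≤n (N₂ u v)))
    search (suc fuel) {u} {v} u~v n< with Fin.all? (Covers? u v)
    ... | yes covers = inj₁ (u , v , u~v , covers)
    ... | no ¬covers with Fin.¬∀⟶∃¬ n _ (Covers? u v) ¬covers
    ...   | x , ¬cx with exit-edge (Covers u v) (Covers? u v) (inj₂ u~v) ¬cx (con u x)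
    ...     | y , z , inj₁ y~u , ¬cz , y~z with inducedP4-or-wider u~v y~u y~z ¬cz
    ...       | inj₁ p     = inj₂ p
    ...       | inj₂ wider = search fuel (~-sym y~u) (spend n< wider)
    search (suc fuel) {u} {v} u~v n< | no _ | _ | y , z , inj₂ y~v , ¬cz , y~z
      with inducedP4-or-wider (~-sym u~v) y~v y~z (¬cz ∘ swap)
    ... | inj₁ p     = inj₂ p
    ... | inj₂ wider =
      search fuel (~-sym y~v) (spend n< (subst (_< _) (cong ∣_∣ (Sub.∪-comm (N v) (N u))) wider))

  Apart : Fin n → Fin n → Set
  Apart u v = u ≢ v × ¬ u ~ v

  Apart? : ∀ u v → Dec (Apart u v)
  Apart? u v = ¬? (u Fin.≟ v) ×-dec ¬? (u ~? v)

  Apart-sym : ∀ {u v} → Apart u v → Apart v u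
  Apart-sym (u≢v , u≁v) = u≢v ∘ ≡-sym , ≁-sym u≁v

  Near : Fin n → Fin n → Set
  Near w s = w ≡ s ⊎ w ~ s

  ¬Apart⇒Near : ∀ {w s} → ¬ Apart w s → Near w s
  ¬Apart⇒Near {w} {s} ¬apart with w Fin.≟ s | w ~? s
  ... | yes w≡s | _       = inj₁ w≡s
  ... | no _    | yes w~s = inj₂ w~s
  ... | no w≢s  | no w≁s  = ⊥-elim (¬apart (w≢s , w≁s))

  maximal-independent : (P : Fin n → Set) → Decidable P →
    ∃ λ S → All P S × AllPairs Apart S × (∀ {w} → P w → Any (Near w) S)
  maximal-independent P P? =
    let S , PS , apart , covers = greedy (List.allFin n)
    in  S , PS , apart , covers (Membership.∈-allFin _)
    where
    cover-∷ : ∀ {x xs S} → (P x → Any (Near x) S) →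
              (∀ {w} → w ∈ₗ xs → P w → Any (Near w) S) →
              ∀ {w} → w ∈ₗ x ∷ xs → P w → Any (Near w) S
    cover-∷ covers-x _      (here refl) = covers-x
    cover-∷ _       covers (there w∈xs) = covers w∈xs

    greedy : (xs : List (Fin n)) →
      ∃ λ S → All P S × AllPairs Apart S × (∀ {w} → w ∈ₗ xs → P w → Any (Near w) S)
    greedy [] = [] , [] , [] , λ ()
    greedy (x ∷ xs) with greedy xs
    ... | S , PS , apart , covers with P? x | All.all? (Apart? x) S
    ...   | yes Px | yes x-apart =
      x ∷ S , Px ∷ PS , x-apart ∷ apart ,
      cover-∷ (λ _ → here (inj₁ refl)) (λ w∈xs → there ∘ covers w∈xs)
    ...   | yes _  | no ¬x-apart =
      S , PS , apart ,
      cover-∷ (λ _ → Any.map ¬Apart⇒Near (All.¬All⇒Any¬ (Apart? x) S ¬x-apart)) covers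
    ...   | no ¬Px | _ = S , PS , apart , cover-∷ (⊥-elim ∘ ¬Px) covers

  module _ (p : InducedP4) where
    open InducedP4 p

    path : List (Fin n)
    path = a ∷ b ∷ c ∷ d ∷ []

    Far : Fin n → Set
    Far w = ¬ Any (w ~_) path

    Far? : Decidable Far
    Far? w = ¬? (Any.any? (w ~?_) path)

    module _ {r : ℕ} (g : Fin r → Fin n) (far : ∀ j → Far (g j))
             (apart : ∀ {i j} → i ≢ j → Apart (g i) (g j)) where

      emb : Fin (4 + r) → Fin n
      emb 0F      = a
      emb 1F      = b
      emb 2F      = c
      emb 3F      = d
      emb (iso j) = g j

      g≁a : ∀ j → ¬ g j ~ a
      g≁a j = far j ∘ here
      g≁b : ∀ j → ¬ g j ~ b
      g≁b j = far j ∘ there ∘ here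
      g≁c : ∀ j → ¬ g j ~ c
      g≁c j = far j ∘ there ∘ there ∘ here
      g≁d : ∀ j → ¬ g j ~ d
      g≁d j = far j ∘ there ∘ there ∘ there ∘ here

      a≢b : a ≢ b
      a≢b = ~⇒≢ a~b
      b≢c : b ≢ c
      b≢c = ~⇒≢ b~c
      c≢d : c ≢ d
      c≢d = ~⇒≢ c~d
      c≢a : c ≢ a
      c≢a = separated c~d a≁d
      a≢d : a ≢ d
      a≢d = separated a~b (≁-sym b≁d)
      b≢d : b ≢ d
      b≢d = separated (~-sym a~b) (≁-sym a≁d)

      a≢g : ∀ j → a ≢ g j
      a≢g j = separated a~b (g≁b j)
      b≢g : ∀ j → b ≢ g j
      b≢g j = separated (~-sym a~b) (g≁a j)
      c≢g : ∀ j → c ≢ g j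
      c≢g j = separated (~-sym b~c) (g≁b j)
      d≢g : ∀ j → d ≢ g j
      d≢g j = separated (~-sym c~d) (g≁c j)

      g-injective : ∀ {i j} → g i ≡ g j → i ≡ j
      g-injective {i} {j} gi≡gj with i Fin.≟ j
      ... | yes i≡j = i≡j
      ... | no i≢j  = ⊥-elim (proj₁ (apart i≢j) gi≡gj)

      emb-injective : ∀ {i j} → emb i ≡ emb j → i ≡ j
      emb-injective {0F}    {0F}    _ = refl
      emb-injective {0F}    {1F}    e = ⊥-elim (a≢b e)
      emb-injective {0F}    {2F}    e = ⊥-elim (c≢a (≡-sym e))
      emb-injective {0F}    {3F}    e = ⊥-elim (a≢d e)
      emb-injective {0F}    {iso j} e = ⊥-elim (a≢g j e)
      emb-injective {1F}    {0F}    e = ⊥-elim (a≢b (≡-sym e))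
      emb-injective {1F}    {1F}    _ = refl
      emb-injective {1F}    {2F}    e = ⊥-elim (b≢c e)
      emb-injective {1F}    {3F}    e = ⊥-elim (b≢d e)
      emb-injective {1F}    {iso j} e = ⊥-elim (b≢g j e)
      emb-injective {2F}    {0F}    e = ⊥-elim (c≢a e)
      emb-injective {2F}    {1F}    e = ⊥-elim (b≢c (≡-sym e))
      emb-injective {2F}    {2F}    _ = refl
      emb-injective {2F}    {3F}    e = ⊥-elim (c≢d e)
      emb-injective {2F}    {iso j} e = ⊥-elim (c≢g j e)
      emb-injective {3F}    {0F}    e = ⊥-elim (a≢d (≡-sym e))
      emb-injective {3F}    {1F}    e = ⊥-elim (b≢d (≡-sym e))
      emb-injective {3F}    {2F}    e = ⊥-elim (c≢d (≡-sym e))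
      emb-injective {3F}    {3F}    _ = refl
      emb-injective {3F}    {iso j} e = ⊥-elim (d≢g j e)
      emb-injective {iso i} {0F}    e = ⊥-elim (a≢g i (≡-sym e))
      emb-injective {iso i} {1F}    e = ⊥-elim (b≢g i (≡-sym e))
      emb-injective {iso i} {2F}    e = ⊥-elim (c≢g i (≡-sym e))
      emb-injective {iso i} {3F}    e = ⊥-elim (d≢g i (≡-sym e))
      emb-injective {iso i} {iso j} e = cong (Fin.suc ∘ Fin.suc ∘ Fin.suc ∘ Fin.suc) (g-injective e)

      emb-adj : ∀ i j → P4rAdj i j ⇔ emb i ~ emb j
      emb-adj 0F      0F      = neither⇔ (¬P4rAdj (λ ()) (λ ())) ~-irrefl
      emb-adj 0F      1F      = both⇔ (fwd (s≤s (s≤s z≤n)) refl) a~b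
      emb-adj 0F      2F      = neither⇔ (¬P4rAdj (λ ()) (λ ())) a≁c
      emb-adj 0F      3F      = neither⇔ (¬P4rAdj (λ ()) (λ ())) a≁d
      emb-adj 0F      (iso j) = neither⇔ isolatedʳ (≁-sym (g≁a j))
      emb-adj 1F      0F      = both⇔ (bwd (s≤s (s≤s z≤n)) refl) (~-sym a~b)
      emb-adj 1F      1F      = neither⇔ (¬P4rAdj (λ ()) (λ ())) ~-irrefl
      emb-adj 1F      2F      = both⇔ (fwd (s≤s (s≤s (s≤s z≤n))) refl) b~c
      emb-adj 1F      3F      = neither⇔ (¬P4rAdj (λ ()) (λ ())) b≁d
      emb-adj 1F      (iso j) = neither⇔ isolatedʳ (≁-sym (g≁b j))
      emb-adj 2F      0F      = neither⇔ (¬P4rAdj (λ ()) (λ ())) (≁-sym a≁c)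
      emb-adj 2F      1F      = both⇔ (bwd (s≤s (s≤s (s≤s z≤n))) refl) (~-sym b~c)
      emb-adj 2F      2F      = neither⇔ (¬P4rAdj (λ ()) (λ ())) ~-irrefl
      emb-adj 2F      3F      = both⇔ (fwd (s≤s (s≤s (s≤s (s≤s z≤n)))) refl) c~d
      emb-adj 2F      (iso j) = neither⇔ isolatedʳ (≁-sym (g≁c j))
      emb-adj 3F      0F      = neither⇔ (¬P4rAdj (λ ()) (λ ())) (≁-sym a≁d)
      emb-adj 3F      1F      = neither⇔ (¬P4rAdj (λ ()) (λ ())) (≁-sym b≁d)
      emb-adj 3F      2F      = both⇔ (bwd (s≤s (s≤s (s≤s (s≤s z≤n)))) refl) (~-sym c~d)
      emb-adj 3F      3F      = neither⇔ (¬P4rAdj (λ ()) (λ ())) ~-irrefl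
      emb-adj 3F      (iso j) = neither⇔ isolatedʳ (≁-sym (g≁d j))
      emb-adj (iso i) 0F      = neither⇔ isolatedˡ (g≁a i)
      emb-adj (iso i) 1F      = neither⇔ isolatedˡ (g≁b i)
      emb-adj (iso i) 2F      = neither⇔ isolatedˡ (g≁c i)
      emb-adj (iso i) 3F      = neither⇔ isolatedˡ (g≁d i)
      emb-adj (iso i) (iso j) with i Fin.≟ j
      ... | yes refl = neither⇔ isolatedˡ ~-irrefl
      ... | no i≢j   = neither⇔ isolatedˡ (proj₂ (apart i≢j))

      P4∪rK1-induced : InducedSub (P4∪rK1 r) G
      P4∪rK1-induced = emb , emb-injective , emb-adj

    -- In path ++ S ++ nbr S, each s ∈ S is dominated by its chosen neighbour nbr s.
    far-cover⇒γt≤ : (nbr : ∀ v → ∃ (v ~_)) → (S : List (Fin n)) →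
                    (∀ {w} → Far w → Any (Near w) S) →
                    γt≤ G (4 + (length S + length S))
    far-cover⇒γt≤ nbr S covers = subst (γt≤ G) size (γt≤length D dom)
      where
      nbr₁ : Fin n → Fin n
      nbr₁ = proj₁ ∘ nbr

      D : List (Fin n)
      D = path ++ S ++ List.map nbr₁ S

      size : length D ≡ 4 + (length S + length S)
      size = cong (4 +_) (≡-trans (List.length-++ S) (cong (length S +_) (List.length-map nbr₁ S)))

      dom : ∀ w → ∃ λ u → u ∈ₗ D × w ~ u
      dom w with Any.any? (w ~?_) path
      ... | yes near-path with find near-path
      ...   | u , u∈path , w~u = u , Membership.∈-++⁺ˡ u∈path , w~u
      dom w | no far-w with find (covers far-w)
      ... | s , s∈S , inj₁ refl =
        nbr₁ s , Membership.∈-++⁺ʳ path (Membership.∈-++⁺ʳ S (Membership.∈-map⁺ nbr₁ s∈S)) ,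
        proj₂ (nbr s)
      ... | s , s∈S , inj₂ w~s = s , Membership.∈-++⁺ʳ path (Membership.∈-++⁺ˡ s∈S) , w~s

    inducedP4⇒γt≤2r+2 : ∀ r → Free (P4∪rK1 r) G → (∀ v → ∃ (v ~_)) → γt≤ G (2 * r + 2)
    inducedP4⇒γt≤2r+2 r free nbr with maximal-independent Far Far?
    ... | S , far , apart , covers with r ℕ.≤? length S
    ...   | no r≰∣S∣ = γt≤-mono (4+2l≤2r+2 (ℕ.≰⇒> r≰∣S∣)) (far-cover⇒γt≤ nbr S covers)
    ...   | yes r≤∣S∣ = ⊥-elim (free (P4∪rK1-induced g (All.lookup far ∘ Membership.∈-lookup ∘ index) g-apart))
      where
      index : Fin r → Fin (length S)
      index j = Fin.inject≤ j r≤∣S∣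

      g : Fin r → Fin n
      g = List.lookup S ∘ index

      g-apart : ∀ {i j} → i ≢ j → Apart (g i) (g j)
      g-apart {i} {j} i≢j = AllPairs-lookup Apart-sym apart (i≢j ∘ Fin.inject≤-injective _ _ i j)

lemma7 : (r : ℕ) → 1 ≤ r → {n : ℕ} → 2 ≤ n → (G : Graph n) →
    Connected G → Free (P4∪rK1 r) G → γt≤ G (2 * r + 2)
lemma7 r _ (s≤s (s≤s _)) G con free =
  [ γt≤-mono G (ℕ.m≤n+m 2 (2 * r)) ∘ DominatingEdge⇒γt≤2 G
  , (λ p → inducedP4⇒γt≤2r+2 G p r free nbr)
  ]′ (dominatingEdge-or-inducedP4 G con (proj₂ (nbr Fin.zero)))
  where
  nbr : ∀ v → ∃ (Adj G v)
  nbr = has-neighbour G con {Fin.zero} {Fin.suc Fin.zero} (λ ())
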